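{- Let $(D,\sqsubseteq,\oplus,\mathcal B)$ be an interpretation monoid with basis semantics for elementary commands as described in the context. For every regular command $r$ and every subset $X\subseteq D$ that is dense with respect to $\mathcal B$, $[\![r]\!](\bigsqcup X)=\bigsqcup_{d\in X}[\![r]\!]d$.
   Context: Let $(D,\sqsubseteq)$ be a complete lattice with join $\sqcup$, bottom $\bot$. A (join) basis is $\mathcal B\subseteq D$ with $d=\bigsqcup\mathcal B_d$ for all $d$, where $\mathcal B_d=\{b\in\mathcal B\mid b\sqsubseteq d\}$; pointed if $\bot\in\mathcal B$. $X\subseteq D$ is dense (w.r.t. $\mathcal B$) if for every $b\in\mathcal B$ with $b\sqsubseteq\bigsqcup X$ there is $x\in X$ with $b\sqsubseteq x$. For $X\subseteq D$, $\downarrow X=\{d\mid\exists x\in X.\ d\sqsubseteq x\}$; weight $w(d)=\min\{|Y|:Y\subseteq\mathcal B_d,\downarrow Y=\downarrow\mathcal B_d\}$, $w(X)=\sup_{d\in X}w(d)$. A complete monoid $(M,\oplus)$ assigns to every family $(m_i)_{i\in I}$ ($I$ arbitrary) an element $\bigoplus_{i\in I}m_i$ with $\bigoplus_{i\in\{j\}}m_i=m_j$ and $\bigoplus_{i\in I}m_i=\bigoplus_{j\in J}\bigoplus_{i\in I_j}m_i$ for every partition $(I_j)_{j\in J}$ of $I$; $0_\oplus$ is the empty sum. $\langle S\rangle$ is the least complete submonoid containing $S$. An ordered complete monoid is a complete monoid with a partial order for which $\oplus$ is monotone. For a cardinal $\kappa$, a $\kappa$-quantale is an ordered complete monoid in which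 every subset of cardinality $\le\kappa$ has a join and $\bigoplus_{i\in I}\bigsqcup_{j\in J_i}x_{i,j}=\bigsqcup_{\beta}\bigoplus_{i\in I}x_{i,\beta(i)}$ for all index sets $I$ and nonempty $J_i$ with $|J_i|\le\kappa$ ($\beta(i)\in J_i$; right-hand join required to exist). An interpretation monoid $(D,\sqsubseteq,\oplus,\mathcal B)$: $(D,\sqsubseteq,\oplus)$ ordered complete monoid, $(D,\sqsubseteq)$ complete lattice, $\mathcal B$ pointed basis, $\langle\mathcal B\rangle$ a $\kappa_D$-quantale with $\kappa_D=w(\langle\mathcal B\rangle)$. Commands and semantics. $r::=e\mid r;r\mid r+r\mid r^*$ over elementary commands including $\mathsf0,\mathsf1$; $r^0=\mathsf1$, $r^{i+1}=r;r^i$. For $f:\mathcal B\to D$, $f^+(d)=\bigsqcup_{b\in\mathcal B_d}f(b)$. Each elementary $e$ has a monotone $[\![e]\!]_{\mathcal B}:\mathcal B\to\langle\mathcal B\rangle$ with $[\![\mathsf0]\!]_{\mathcal B}b=0_\oplus$, $[\![\mathsf1]\!]_{\mathcal B}b=b$; $[\![r_1;r_2]\!]_{\mathcal B}b=([\![r_2]\!]_{\mathcal B})^+([\![r_1]\!]_{\mathcal B}b)$, $[\![r_1+r_2]\!]_{\mathcal B}b=[\![r_1]\!]_{\mathcal B}b\oplus[\![r_2]\!]_{\mathcal B}b$, $[\![r^*]\!]_{\mathcal B}b=\bigoplus_{i\ge0}[\![r^i]\!]_{\mathcal B}b$; full semantics $[\![r]\!]=([\![r]\!]_{\mathcal B})^+:D\to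 D$. -}

module Defs where

open import Level using (Level)
open import Data.Bool using (Bool; if_then_else_)
open import Data.Empty using (⊥; ⊥-elim)
open import Data.Unit using (⊤; tt)
open import Data.Nat using (ℕ; zero; suc)
open import Data.Product using (Σ; Σ-syntax; _×_; _,_; proj₁; proj₂)
open import Function.Bundles using (_↔_; Inverse)
open import Function.Definitions using (Injective)
open import Relation.Binary.PropositionalEquality using (_≡_)
open import Relation.Binary.Structures using (IsPartialOrder)

-- Subsets of D are predicates D → Set; index sets are arbitrary types
-- I : Set; a partition (I_j)_{j∈J} of I is a bijection Σ J P ↔ I.

record OCMLattice : Set₁ where
  field
    D      : Set
    _⊑_    : D → D → Set
    ⊑-po   : IsPartialOrder _≡_ _⊑_
    ⨆      : (D → Set) → D
    ⨆-ub   : (S : D → Set) (d : D) → S d → d ⊑ ⨆ S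
    ⨆-least : (S : D → Set) (u : D) → ((d : D) → S d → d ⊑ u) → ⨆ S ⊑ u
    ⨁      : {I : Set} → (I → D) → D
    -- sums of (extensionally) equal families are equal (set-theoretic
    -- families are extensional; this replaces function extensionality)
    ⨁-cong : {I : Set} (m m′ : I → D) → ((i : I) → m i ≡ m′ i) → ⨁ m ≡ ⨁ m′
    ⨁-single : (m : ⊤ → D) → ⨁ m ≡ m tt
    ⨁-partition : {I J : Set} (P : J → Set) (e : Σ J P ↔ I) (m : I → D) →
                  ⨁ m ≡ ⨁ (λ j → ⨁ (λ (p : P j) → m (Inverse.to e (j , p))))
    ⨁-mono : {I : Set} (m m′ : I → D) → ((i : I) → m i ⊑ m′ i) → ⨁ m ⊑ ⨁ m′

module _ (M : OCMLattice) where
  open OCMLattice M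

  bot : D
  bot = ⨆ (λ _ → ⊥)

  0⊕ : D
  0⊕ = ⨁ {⊥} ⊥-elim

  _⊕_ : D → D → D
  a ⊕ b = ⨁ {Bool} (λ t → if t then a else b)

  Below : (D → Set) → D → D → Set
  Below B d b = B b × b ⊑ d

  Down : (D → Set) → D → Set
  Down X e = Σ[ x ∈ D ] (X x × e ⊑ x)

  IsBasis : (D → Set) → Set
  IsBasis B = (d : D) → d ≡ ⨆ (Below B d)

  -- ⟨S⟩: least complete submonoid containing S (inductive closure)
  data Gen (S : D → Set) : D → Set₁ where
    base : {d : D} → S d → Gen S d
    sum  : {I : Set} (m : I → D) → ((i : I) → Gen S (m i)) → Gen S (⨁ m)

  -- |Y| ≤ |L| for a subset Y of D (counting elements of D, not proofs)
  SubInj : (D → Set) → Set → Set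
  SubInj Y L = Σ[ f ∈ (Σ D Y → L) ] ((p q : Σ D Y) → f p ≡ f q → proj₁ p ≡ proj₁ q)

  TyInj : Set → Set → Set
  TyInj J L = Σ[ f ∈ (J → L) ] Injective _≡_ _≡_ f

  -- w(d) ≤ |L|  (w(d) is a minimum, so this means some admissible Y has |Y| ≤ |L|)
  WeightLe : (B : D → Set) → D → Set → Set₁
  WeightLe B d L =
    Σ[ Y ∈ (D → Set) ]
      (((y : D) → Y y → Below B d y) ×
       ((e : D) → (Down Y e → Down (Below B d) e) × (Down (Below B d) e → Down Y e)) ×
       SubInj Y L)

  -- |L| is an upper bound of { w(d) | d ∈ ⟨B⟩ }, i.e. κ_D ≤ |L| candidates
  KappaUpper : (B : D → Set) → Set → Set₁
  KappaUpper B L = (d : D) → Gen B d → WeightLe B d L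

  -- |J| ≤ κ_D = sup { w(d) | d ∈ ⟨B⟩ }: J injects into every upper bound
  SmallT : (B : D → Set) → Set → Set₁
  SmallT B J = (L : Set) → KappaUpper B L → TyInj J L

  SmallS : (B : D → Set) → (D → Set) → Set₁
  SmallS B S = (L : Set) → KappaUpper B L → SubInj S L

  IsLubIn : (B : D → Set) → (D → Set) → D → Set₁
  IsLubIn B S j = Gen B j × ((d : D) → S d → d ⊑ j) ×
                  ((u : D) → Gen B u → ((d : D) → S d → d ⊑ u) → j ⊑ u)

  -- ⟨B⟩ is a κ_D-quantale (it is closed under ⊕ by construction, order inherited)
  record IsKappaQuantale (B : D → Set) : Set₂ where
    field
      joins : (S : D → Set) → ((d : D) → S d → Gen B d) → SmallS B S →
              Σ[ j ∈ D ] IsLubIn B S j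
      distrib : {I : Set} (J : I → Set) → ((i : I) → J i) →
                ((i : I) → SmallT B (J i)) →
                (x : (i : I) → J i → D) → ((i : I) (j : J i) → Gen B (x i j)) →
                (y : I → D) → ((i : I) → IsLubIn B (λ d → Σ[ j ∈ J i ] d ≡ x i j) (y i)) →
                IsLubIn B (λ d → Σ[ β ∈ ((i : I) → J i) ] d ≡ ⨁ (λ i → x i (β i))) (⨁ y)

record InterpMonoid : Set₂ where
  field
    M : OCMLattice
  open OCMLattice M
  field
    B        : D → Set
    basis    : IsBasis M B
    pointed  : B (bot M)
    quantale : IsKappaQuantale M B

-- Basis semantics of elementary commands (besides 𝟘 and 𝟙):
-- monotone maps B → ⟨B⟩ (represented as functions D → D; only their
-- values on basis elements are ever used).
record ElemSem (IM : InterpMonoid) : Set₂ where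
  open InterpMonoid IM
  open OCMLattice M
  field
    E        : Set
    sem      : E → D → D
    sem-mono : (e : E) (b b′ : D) → B b → B b′ → b ⊑ b′ → sem e b ⊑ sem e b′
    sem-gen  : (e : E) (b : D) → B b → Gen M B (sem e b)

data Cmd (E : Set) : Set where
  el   : E → Cmd E
  𝟘 𝟙  : Cmd E
  _⨾_  : Cmd E → Cmd E → Cmd E
  _∔_  : Cmd E → Cmd E → Cmd E
  _⋆   : Cmd E → Cmd E

module Semantics (IM : InterpMonoid) (S : ElemSem IM) where
  open InterpMonoid IM
  open OCMLattice M
  open ElemSem S

  lift : (D → D) → D → D
  lift f d = ⨆ (λ e → Σ[ b ∈ D ] (Below M B d b × e ≡ f b))

  -- ⟦r^i⟧_B given ⟦r⟧_B:  ⟦r^0⟧_B b = ⟦𝟙⟧_B b = b,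
  -- ⟦r^(i+1)⟧_B b = ⟦r ; r^i⟧_B b = (⟦r^i⟧_B)⁺ (⟦r⟧_B b)
  pow : (D → D) → ℕ → D → D
  pow f zero    b = b
  pow f (suc i) b = lift (pow f i) (f b)

  ⟦_⟧B : Cmd E → D → D
  ⟦ el e ⟧B b    = sem e b
  ⟦ 𝟘 ⟧B b       = 0⊕ M
  ⟦ 𝟙 ⟧B b       = b
  ⟦ r₁ ⨾ r₂ ⟧B b = lift ⟦ r₂ ⟧B (⟦ r₁ ⟧B b)
  ⟦ r₁ ∔ r₂ ⟧B b = _⊕_ M (⟦ r₁ ⟧B b) (⟦ r₂ ⟧B b)
  ⟦ r ⋆ ⟧B b     = ⨁ (λ (i : ℕ) → pow ⟦ r ⟧B i b)

  ⟦_⟧ : Cmd E → D → D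
  ⟦ r ⟧ = lift ⟦ r ⟧B

  Dense : (D → Set) → Set
  Dense X = (b : D) → B b → b ⊑ ⨆ X → Σ[ x ∈ D ] (X x × b ⊑ x)

{-# OPTIONS --safe #-}
module Submission where

open import Defs
open import Data.Product using (Σ; Σ-syntax; _×_; _,_)
open import Relation.Binary.PropositionalEquality using (_≡_; refl)
open import Relation.Binary.Structures using (IsPartialOrder)

-- The semantics of every command is the extension f⁺ of a map f on the
-- basis, and f⁺ d is the join of f[B_d].  A basis element below ⨆ X lies
-- below some x ∈ X by density, so f⁺ (⨆ X) ⊑ ⨆ f⁺[X]; the converse holds
-- because f⁺ is monotone.  Nothing about ⊕ or the shape of f is needed.

module DenseJoins (M : OCMLattice) (B : OCMLattice.D M → Set) where
  open OCMLattice M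
  open IsPartialOrder ⊑-po using (antisym; trans)

  image : (D → D) → (D → Set) → D → Set
  image f X e = Σ[ d ∈ D ] (X d × e ≡ f d)

  -- Semantics.lift and Semantics.Dense, which depend only on M and B.
  lift : (D → D) → D → D
  lift f d = ⨆ (image f (Below M B d))

  IsDense : (D → Set) → Set
  IsDense X = (b : D) → B b → b ⊑ ⨆ X → Σ[ x ∈ D ] (X x × b ⊑ x)

  ⨆-image-lift⊑lift-⨆ : (f : D → D) (X : D → Set) →
                         ⨆ (image (lift f) X) ⊑ lift f (⨆ X)
  ⨆-image-lift⊑lift-⨆ f X = ⨆-least _ _ λ where
    _ (d , Xd , refl) → ⨆-least _ _ λ where
      _ (b , (Bb , b⊑d) , refl) →
        ⨆-ub _ (f b) (b , (Bb , trans b⊑d (⨆-ub X d Xd)) , refl)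

  lift-⨆⊑⨆-image-lift : (f : D → D) (X : D → Set) → IsDense X →
                         lift f (⨆ X) ⊑ ⨆ (image (lift f) X)
  lift-⨆⊑⨆-image-lift f X dense = ⨆-least _ _ λ where
    _ (b , (Bb , b⊑⨆X) , refl) →
      let (x , Xx , b⊑x) = dense b Bb b⊑⨆X in
      trans (⨆-ub _ (f b) (b , (Bb , b⊑x) , refl))
            (⨆-ub _ (lift f x) (x , Xx , refl))

  lift-⨆-dense : (f : D → D) (X : D → Set) → IsDense X →
                 lift f (⨆ X) ≡ ⨆ (image (lift f) X)
  lift-⨆-dense f X dense =
    antisym (lift-⨆⊑⨆-image-lift f X dense) (⨆-image-lift⊑lift-⨆ f X)

lemma2p12 : (IM : InterpMonoid) (S : ElemSem IM) →
    let open InterpMonoid IM in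
    let open OCMLattice M in
    let open ElemSem S in
    let open Semantics IM S in
    (r : Cmd E) (X : D → Set) → Dense X →
    ⟦ r ⟧ (⨆ X) ≡ ⨆ (λ e → Σ[ d ∈ D ] (X d × e ≡ ⟦ r ⟧ d))
lemma2p12 IM S r =
  DenseJoins.lift-⨆-dense M B (Semantics.⟦_⟧B IM S r)
  where open InterpMonoid IM
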